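{- Let $(\Delta,\lambda,\iota,\zeta)$ be a ccv-graph, $\Gamma=\mathrm{Cov}(\Delta,\lambda,\iota,\zeta)$ and $\pi:\Gamma\to\Delta$ the natural projection. If $C$ is a cycle in $\Gamma$, then $\pi(C)$ is a $\lambda$-reduced closed walk in $\Delta$ and $0\in\mathrm{end}(\pi(C))$.
   Context: A graph is a quadruple $(V,D;\mathrm{beg},{}^{ -1})$ with finite nonempty vertex set $V$, finite dart set $D$, $\mathrm{beg}:D\to V$ and an involution ${}^{ -1}$ on $D$; $\mathrm{end}\,x=\mathrm{beg}\,x^{ -1}$. A walk is a sequence of darts $(x_1,\dots,x_k)$ with $\mathrm{beg}\,x_{i+1}=\mathrm{end}\,x_i$; it is closed if $\mathrm{end}\,x_k=\mathrm{beg}\,x_1$, reduced if $x_{i+1}\ne x_i^{ -1}$ for all $i$; a cycle is a closed reduced walk whose darts have pairwise distinct initial vertices. A cyclic generalised voltage graph is $(\Delta,\lambda,\iota,\zeta)$ with $\Delta$ finite connected, $\lambda:D(\Delta)\to\mathbb{N}$, $\iota:V(\Delta)\to\mathbb{N}$, $\zeta:D(\Delta)\to\mathbb{Z}$ such that $\lambda(x)\iota(\mathrm{beg}\,x)=\lambda(x^{ -1})\iota(\mathrm{beg}\,x^{ -1})$ and $\zeta(x^{ -1})\equiv-\zeta(x)\pmod{\lambda(x)\iota(\mathrm{beg}\,x)}$ for all darts $x$. Its cover has vertices $(v,i)$, $0\le i<\iota(v)$, darts $(x,i)$, $0\le i<\lambda(x)\iota(\mathrm{beg}\,x)$, $\mathrm{beg}(x,i)=(\mathrm{beg}\,x,\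 i\bmod\iota(\mathrm{beg}\,x))$, $(x,i)^{ -1}=(x^{ -1},\ i+\zeta(x)\bmod\lambda(x)\iota(\mathrm{beg}\,x))$; $\pi$ sends $(v,i)\mapsto v$, $(x,i)\mapsto x$, and for a walk $\pi$ is applied dartwise. It is a ccv-graph if the cover is finite, connected, simple and $3$-valent. A walk $W=(x_1,\dots,x_k)$ in $\Delta$ is $\lambda$-reduced if $x_{i+1}\ne x_i^{ -1}$ whenever $\lambda(x_i^{ -1})=1$, and $x_k\ne x_1^{ -1}$ whenever $\lambda(x_1)=1$. For a walk $W=(x_1,\dots,x_k)$ with $d=\gcd\{\iota(\mathrm{beg}\,x_i)\}$, the endset is $\mathrm{end}(W)=\{\sum_{i}\zeta(x_i)+jd : j\in\mathbb{Z}\}$ reduced modulo $\iota(\mathrm{end}\,x_k)$. -}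

module Defs where

open import Level using (0ℓ)
open import Data.Nat as ℕ using (ℕ; NonZero)
open import Data.Nat.Properties using (m*n≢0)
open import Data.Nat.GCD using (gcd)
open import Data.Nat.DivMod using (_mod_)
open import Data.Integer as ℤ using (ℤ; +_; _%ℕ_)
open import Data.Integer.DivMod using (n%ℕd<d)
open import Data.Integer.Divisibility using () renaming (_∣_ to _∣ℤ_)
open import Data.Fin using (Fin; toℕ; fromℕ<)
open import Data.List using (List; []; _∷_; map; foldr)
open import Data.List.Relation.Unary.Unique.Propositional using (Unique)
open import Data.Product using (Σ; ∃; ∃-syntax; _×_; _,_; proj₁; proj₂)
open import Data.Unit using (⊤)
open import Data.Empty using (⊥)
open import Function.Bundles using (_↔_)
open import Relation.Nullary using (¬_)
open import Relation.Binary.PropositionalEquality using (_≡_; _≢_)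

-- Graphs (V, D; beg, ⁻¹).  The data (V, D, beg, inv) is a PreGraph;
-- a Graph additionally has inv an involution.

record PreGraph : Set₁ where
  field
    V   : Set
    D   : Set
    beg : D → V
    inv : D → D

  end : D → V
  end x = beg (inv x)

Finite : Set → Set
Finite A = ∃[ n ] (A ↔ Fin n)

-- a finite graph: finite nonempty vertex set, finite dart set,
-- inv an involution
IsFiniteGraph : PreGraph → Set
IsFiniteGraph Γ = Finite V × Finite D × V × (∀ x → inv (inv x) ≡ x)
  where open PreGraph Γ

module _ (Γ : PreGraph) where
  open PreGraph Γ

  IsWalk : List D → Set
  IsWalk []           = ⊤
  IsWalk (x ∷ [])     = ⊤
  IsWalk (x ∷ y ∷ ys) = beg y ≡ end x × IsWalk (y ∷ ys)

  lastD : D → List D → D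
  lastD x []       = x
  lastD x (y ∷ ys) = lastD y ys

  IsClosed : List D → Set
  IsClosed []       = ⊥
  IsClosed (x ∷ xs) = end (lastD x xs) ≡ beg x

  IsReduced : List D → Set
  IsReduced []           = ⊤
  IsReduced (x ∷ [])     = ⊤
  IsReduced (x ∷ y ∷ ys) = y ≢ inv x × IsReduced (y ∷ ys)

  IsCycle : List D → Set
  IsCycle W = IsWalk W × IsClosed W × IsReduced W × Unique (map beg W)

  WalkFromTo : V → V → List D → Set
  WalkFromTo u v []       = u ≡ v
  WalkFromTo u v (x ∷ xs) = beg x ≡ u × end (lastD x xs) ≡ v × IsWalk (x ∷ xs)

  Connected : Set
  Connected = ∀ u v → ∃[ W ] WalkFromTo u v W

  -- simple: no loops (hence no semi-edges) and no parallel darts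
  Simple : Set
  Simple = (∀ x → beg x ≢ end x)
         × (∀ x y → beg x ≡ beg y → end x ≡ end y → x ≡ y)

  ThreeValent : Set
  ThreeValent = ∀ v → Σ D (λ x → beg x ≡ v) ↔ Fin 3

record CGVGraph (Δ : PreGraph) : Set where
  open PreGraph Δ
  field
    lam   : D → ℕ
    iota  : V → ℕ
    zeta  : D → ℤ
    lam-pos  : ∀ x → NonZero (lam x)
    iota-pos : ∀ v → NonZero (iota v)
    lam-iota : ∀ x → lam x ℕ.* iota (beg x) ≡ lam (inv x) ℕ.* iota (beg (inv x))
    zeta-inv : ∀ x → (+ (lam x ℕ.* iota (beg x))) ∣ℤ (zeta (inv x) ℤ.+ zeta x)

  m : D → ℕ
  m x = lam x ℕ.* iota (beg x)

  m-pos : ∀ x → NonZero (m x)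
  m-pos x = m*n≢0 (lam x) (iota (beg x)) {{lam-pos x}} {{iota-pos (beg x)}}

  Cov : PreGraph
  Cov = record
    { V   = Σ V (λ v → Fin (iota v))
    ; D   = Σ D (λ x → Fin (m x))
    ; beg = λ { (x , i) → beg x , (toℕ i mod iota (beg x)) {{iota-pos (beg x)}} }
    ; inv = λ { (x , i) → inv x ,
                  fromℕ< (n%ℕd<d (+ toℕ i ℤ.+ zeta x) (m (inv x)) {{m-pos (inv x)}}) }
    }

  πW : List (PreGraph.D Cov) → List D
  πW = map proj₁

  LamReduced : List D → Set
  LamReduced []       = ⊥
  LamReduced (x ∷ xs) = Cons (x ∷ xs) × (lam x ≡ 1 → lastD Δ x xs ≢ inv x)
    where
      Cons : List D → Set
      Cons []           = ⊤
      Cons (y ∷ [])     = ⊤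
      Cons (y ∷ z ∷ zs) = (lam (inv y) ≡ 1 → z ≢ inv y) × Cons (z ∷ zs)

  InEndset : List D → ℕ → Set
  InEndset []       a = ⊥
  InEndset (x ∷ xs) a =
    ∃[ j ] ((sumζ ℤ.+ j ℤ.* + d) %ℕ iota (end (lastD Δ x xs))) {{iota-pos _}} ≡ a
    where
      W = x ∷ xs
      sumζ = foldr ℤ._+_ (+ 0) (map zeta W)
      d = foldr gcd 0 (map (λ y → iota (beg y)) W)

IsCCV : (Δ : PreGraph) → CGVGraph Δ → Set
IsCCV Δ G = IsFiniteGraph Δ × Connected Δ
          × Finite (PreGraph.V Cov) × Finite (PreGraph.D Cov)
          × Connected Cov × Simple Cov × ThreeValent Cov
  where open CGVGraph G

-- The projection π : Γ → Δ commutes with beg and ⁻¹, so π(C) is a closed walk.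
-- Over a dart x with λ(x) = 1 the cover darts are determined by their initial
-- vertex; hence a backtrack x, x⁻¹ in π(C) with λ(x⁻¹) = 1 lifts to a backtrack
-- in C, and a wrap-around backtrack would force the last dart of C to be the
-- reverse of the first, contradicting looplessness, reducedness or the distinct
-- initial vertices of C.  Finally, modulo d = gcd ι(beg xᵢ) the index of the end
-- vertex of a cover dart (x, i) is i + ζ(x); along C the index therefore grows by
-- Σ ζ(xᵢ), and as C is closed, d ∣ Σ ζ(xᵢ), i.e. 0 ∈ end(π(C)).

module Submission where

open import Defs
open import Level using (0ℓ)
open import Data.Nat as ℕ using (ℕ; NonZero)
import Data.Nat.Properties as ℕ
open import Data.Nat.Divisibility as ℕ using (_∣_; ∣-trans; ∣n⇒∣m*n)
open import Data.Nat.DivMod using (_%_; m<n⇒m%n≡m; m*n%n≡0)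
open import Data.Nat.GCD using (gcd; gcd[m,n]∣m; gcd[m,n]∣n)
open import Data.Integer as ℤ using (ℤ; +_; _+_; _-_; _*_; -_; _%ℕ_; _/ℕ_)
import Data.Integer.Properties as ℤ
open import Data.Integer.DivMod using (a≡a%ℕn+[a/ℕn]*n; n%ℕd<d)
open import Data.Integer.Divisibility.Signed as ℤ∣ using (divides) renaming (_∣_ to _∣ℤ_)
open import Data.Integer.Tactic.RingSolver using (solve-∀)
open import Data.Fin using (Fin; toℕ)
open import Data.Fin.Properties using (toℕ-fromℕ<; toℕ-injective; toℕ<n)
open import Data.List using (List; []; _∷_; map; foldr)
open import Data.List.Membership.Propositional using (_∈_)
open import Data.List.Membership.Propositional.Properties using (∈-map⁺)
open import Data.List.Relation.Unary.All as All using (All; []; _∷_)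
open import Data.List.Relation.Unary.All.Properties using (map⁻)
open import Data.List.Relation.Unary.Any using (here; there)
open import Data.List.Relation.Unary.AllPairs using (_∷_)
open import Data.Product using (∃; _×_; _,_; proj₁; proj₂)
open import Data.Unit using (tt)
open import Function using (_∘_)
open import Function.Bundles using (Equivalence; _⇔_; mk⇔)
open import Relation.Binary.Bundles using (Setoid)
open import Relation.Binary.Structures using (IsEquivalence)
open import Relation.Binary.PropositionalEquality
import Relation.Binary.Reasoning.Setoid as ≈-Reasoning

infix 4 _≡_[mod_]
record _≡_[mod_] (a b : ℤ) (n : ℕ) : Set where
  constructor mk≡[mod]
  field ∣a-b : + n ∣ℤ a - b
open _≡_[mod_]

module _ {n : ℕ} where

  ≡[mod]-refl : ∀ {a} → a ≡ a [mod n ]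
  ≡[mod]-refl {a} = mk≡[mod] (subst (+ n ∣ℤ_) (sym (ℤ.+-inverseʳ a)) (ℤ∣.∣ᵤ⇒∣ (n ℕ.∣0)))

  ≡[mod]-sym : ∀ {a b} → a ≡ b [mod n ] → b ≡ a [mod n ]
  ≡[mod]-sym {a} {b} (mk≡[mod] n∣a-b) = mk≡[mod] (begin
    + n         ∣⟨ ℤ∣.∣m⇒∣-m n∣a-b ⟩
    - (a - b)   ≡⟨ b-a≡-[a-b] a b ⟨
    b - a       ∎)
    where
    open ℤ∣.∣-Reasoning
    b-a≡-[a-b] : ∀ a b → b - a ≡ - (a - b)
    b-a≡-[a-b] = solve-∀

  ≡[mod]-trans : ∀ {a b c} → a ≡ b [mod n ] → b ≡ c [mod n ] → a ≡ c [mod n ]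
  ≡[mod]-trans {a} {b} {c} (mk≡[mod] n∣a-b) (mk≡[mod] n∣b-c) = mk≡[mod] (begin
    + n                 ∣⟨ ℤ∣.∣m∣n⇒∣m+n n∣a-b n∣b-c ⟩
    (a - b) + (b - c)   ≡⟨ [a-b]+[b-c]≡a-c a b c ⟩
    a - c               ∎)
    where
    open ℤ∣.∣-Reasoning
    [a-b]+[b-c]≡a-c : ∀ a b c → (a - b) + (b - c) ≡ a - c
    [a-b]+[b-c]≡a-c = solve-∀

  +-cong-≡[mod] : ∀ {a b c d} → a ≡ b [mod n ] → c ≡ d [mod n ] → a + c ≡ b + d [mod n ]
  +-cong-≡[mod] {a} {b} {c} {d} (mk≡[mod] n∣a-b) (mk≡[mod] n∣c-d) = mk≡[mod] (begin
    + n                 ∣⟨ ℤ∣.∣m∣n⇒∣m+n n∣a-b n∣c-d ⟩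
    (a - b) + (c - d)   ≡⟨ [a-b]+[c-d]≡[a+c]-[b+d] a b c d ⟩
    (a + c) - (b + d)   ∎)
    where
    open ℤ∣.∣-Reasoning
    [a-b]+[c-d]≡[a+c]-[b+d] : ∀ a b c d → (a - b) + (c - d) ≡ (a + c) - (b + d)
    [a-b]+[c-d]≡[a+c]-[b+d] = solve-∀

≡[mod]-isEquivalence : ∀ n → IsEquivalence _≡_[mod n ]
≡[mod]-isEquivalence n = record
  { refl = ≡[mod]-refl ; sym = ≡[mod]-sym ; trans = ≡[mod]-trans }

≡[mod]-setoid : ℕ → Setoid 0ℓ 0ℓ
≡[mod]-setoid n = record { isEquivalence = ≡[mod]-isEquivalence n }

+≡[mod]⇔∣ : ∀ {n} a s → a + s ≡ a [mod n ] ⇔ + n ∣ℤ s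
+≡[mod]⇔∣ {n} a s = mk⇔ (λ (mk≡[mod] n∣[a+s]-a) → subst (+ n ∣ℤ_) ([a+s]-a≡s a s) n∣[a+s]-a)
                       (λ n∣s → mk≡[mod] (subst (+ n ∣ℤ_) (sym ([a+s]-a≡s a s)) n∣s))
  where
  [a+s]-a≡s : ∀ a s → (a + s) - a ≡ s
  [a+s]-a≡s = solve-∀

+-congʳ-≡[mod] : ∀ {n a b} c → a ≡ b [mod n ] → a + c ≡ b + c [mod n ]
+-congʳ-≡[mod] c a≡b = +-cong-≡[mod] a≡b ≡[mod]-refl

≡[mod]-∣ : ∀ {m n a b} → m ℕ.∣ n → a ≡ b [mod n ] → a ≡ b [mod m ]
≡[mod]-∣ m∣n (mk≡[mod] n∣a-b) = mk≡[mod] (ℤ∣.∣-trans (ℤ∣.∣ᵤ⇒∣ m∣n) n∣a-b)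

%ℕ-≡[mod] : ∀ a n .{{_ : NonZero n}} → + (a %ℕ n) ≡ a [mod n ]
%ℕ-≡[mod] a n = mk≡[mod] (divides (- (a /ℕ n)) (begin
  + (a %ℕ n) - a                           ≡⟨ cong (λ t → + (a %ℕ n) - t) (a≡a%ℕn+[a/ℕn]*n a n) ⟩
  + (a %ℕ n) - (+ (a %ℕ n) + a /ℕ n * + n) ≡⟨ r-[r+q*n]≡[-q]*n (+ (a %ℕ n)) (a /ℕ n) (+ n) ⟩
  - (a /ℕ n) * + n                         ∎))
  where
  open ≡-Reasoning
  r-[r+q*n]≡[-q]*n : ∀ r q n → r - (r + q * n) ≡ (- q) * n
  r-[r+q*n]≡[-q]*n = solve-∀

%ℕ-congʳ : ∀ a {m n} .{{_ : NonZero m}} .{{_ : NonZero n}} → m ≡ n → a %ℕ m ≡ a %ℕ n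
%ℕ-congʳ a refl = refl

≡[mod]⇒%ℕ≡ : ∀ {a b} n .{{_ : NonZero n}} → a ≡ b [mod n ] → a %ℕ n ≡ b %ℕ n
≡[mod]⇒%ℕ≡ {a} {b} n a≡b = ℤ.+-injective (ℤ.i-j≡0⇒i≡j (+ r) (+ s) (ℤ.∣i∣≡0⇒i≡0 ∣r-s∣≡0))
  where
  r = a %ℕ n
  s = b %ℕ n
  n∣∣r-s∣ : n ℕ.∣ ℤ.∣ + r - + s ∣
  n∣∣r-s∣ = ℤ∣.∣⇒∣ᵤ (∣a-b (≡[mod]-trans (%ℕ-≡[mod] a n)
                          (≡[mod]-trans a≡b (≡[mod]-sym (%ℕ-≡[mod] b n)))))
  ∣r-s∣<n : ℤ.∣ + r - + s ∣ ℕ.< n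
  ∣r-s∣<n = begin-strict
    ℤ.∣ + r - + s ∣  ≡⟨ cong ℤ.∣_∣ (ℤ.[+m]-[+n]≡m⊖n r s) ⟩
    ℤ.∣ r ℤ.⊖ s ∣    ≤⟨ ℤ.∣m⊝n∣≤m⊔n r s ⟩
    r ℕ.⊔ s          <⟨ ℕ.⊔-lub (n%ℕd<d a n) (n%ℕd<d b n) ⟩
    n                ∎
    where open ℕ.≤-Reasoning
  ∣r-s∣≡0 : ℤ.∣ + r - + s ∣ ≡ 0
  ∣r-s∣≡0 = trans (sym (m<n⇒m%n≡m ∣r-s∣<n)) (ℕ.n∣m⇒m%n≡0 _ n n∣∣r-s∣)

∣⇒∃[j][s+j*d]%ℕn≡0 : ∀ {d} s n .{{_ : NonZero n}} → + d ∣ℤ s → ∃ λ j → (s + j * + d) %ℕ n ≡ 0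
∣⇒∃[j][s+j*d]%ℕn≡0 {d} _ n (divides q refl) = - q , (begin
  (q * + d + - q * + d) %ℕ n  ≡⟨ cong (_%ℕ n) (q*d+[-q]*d≡0 q (+ d)) ⟩
  0 ℕ.% n                     ≡⟨ m*n%n≡0 0 n ⟩
  0                           ∎)
  where
  open ≡-Reasoning
  q*d+[-q]*d≡0 : ∀ q d → q * d + - q * d ≡ + 0
  q*d+[-q]*d≡0 = solve-∀

foldr-gcd-∣ : ∀ ns → All (foldr gcd 0 ns ∣_) ns
foldr-gcd-∣ []       = []
foldr-gcd-∣ (n ∷ ns) =
  gcd[m,n]∣m n _ ∷ All.map (∣-trans (gcd[m,n]∣n n _)) (foldr-gcd-∣ ns)

lastD-∈ : ∀ Γ x xs → lastD Γ x xs ∈ x ∷ xs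
lastD-∈ Γ x []       = here refl
lastD-∈ Γ x (y ∷ ys) = there (lastD-∈ Γ y ys)

lastD-map : ∀ Γ Δ (f : PreGraph.D Γ → PreGraph.D Δ) x xs →
            lastD Δ (f x) (map f xs) ≡ f (lastD Γ x xs)
lastD-map Γ Δ f x []       = refl
lastD-map Γ Δ f x (y ∷ ys) = lastD-map Γ Δ f y ys

FirstFactor : (P : Set) {A B : Set} → P ≡ (A × B) → Set
FirstFactor _ {A} _ = A

module CoverProjection (Δ : PreGraph) (G : CGVGraph Δ) where
  open PreGraph Δ
  open CGVGraph G
  module Γ = PreGraph Cov

  -- The condition on consecutive darts in LamReduced is a local (unnamed) definition of Defs;
  -- it is recovered here as the first factor of LamReduced, by unification.
  LamReducedSteps : D → List D → Set
  LamReducedSteps x xs = FirstFactor (LamReduced (x ∷ xs)) refl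

  Σζ : List D → ℤ
  Σζ W = foldr _+_ (+ 0) (map zeta W)

  index : Γ.V → ℕ
  index = toℕ ∘ proj₂

  πW-walk : ∀ W → IsWalk Cov W → IsWalk Δ (πW W)
  πW-walk []           _                    = tt
  πW-walk (c ∷ [])     _                    = tt
  πW-walk (c ∷ e ∷ es) (beg-e≡end-c , walk) = cong proj₁ beg-e≡end-c , πW-walk (e ∷ es) walk

  πW-closed : ∀ W → IsClosed Cov W → IsClosed Δ (πW W)
  πW-closed (c ∷ cs) closed = trans (cong end (lastD-map Cov Δ proj₁ c cs)) (cong proj₁ closed)

  private instance
    iota-nonZero : ∀ {v} → NonZero (iota v)
    iota-nonZero {v} = iota-pos v
    m-nonZero : ∀ {x} → NonZero (m x)
    m-nonZero {x} = m-pos x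

  index-beg : ∀ x (i : Fin (m x)) → index (Γ.beg (x , i)) ≡ toℕ i % iota (beg x)
  index-beg x i = toℕ-fromℕ< _

  index-inv : ∀ x (i : Fin (m x)) → toℕ (proj₂ (Γ.inv (x , i))) ≡ (+ toℕ i + zeta x) %ℕ m (inv x)
  index-inv x i = toℕ-fromℕ< _

  beg-≡[mod] : ∀ {d} x (i : Fin (m x)) → d ∣ iota (beg x) →
               + index (Γ.beg (x , i)) ≡ + toℕ i [mod d ]
  beg-≡[mod] x i d∣ι = ≡[mod]-∣ d∣ι (begin
    + index (Γ.beg (x , i))    ≡⟨ cong +_ (index-beg x i) ⟩
    + (toℕ i % iota (beg x))   ≈⟨ %ℕ-≡[mod] (+ toℕ i) (iota (beg x)) ⟩
    + toℕ i                    ∎)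
    where open ≈-Reasoning (≡[mod]-setoid (iota (beg x)))

  end-≡[mod] : ∀ {d} x (i : Fin (m x)) → d ∣ iota (end x) →
               + index (Γ.end (x , i)) ≡ + toℕ i + zeta x [mod d ]
  end-≡[mod] {d} x i d∣ι = begin
    + index (Γ.end (x , i))                ≈⟨ beg-≡[mod] (inv x) (proj₂ (Γ.inv (x , i))) d∣ι ⟩
    + toℕ (proj₂ (Γ.inv (x , i)))          ≡⟨ cong +_ (index-inv x i) ⟩
    + ((+ toℕ i + zeta x) %ℕ m (inv x))    ≈⟨ ≡[mod]-∣ (∣n⇒∣m*n (lam (inv x)) d∣ι)
                                                       (%ℕ-≡[mod] (+ toℕ i + zeta x) (m (inv x))) ⟩
    + toℕ i + zeta x                       ∎
    where open ≈-Reasoning (≡[mod]-setoid d)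

  end-≡[mod]-beg+ζ : ∀ {d} c → d ∣ iota (beg (proj₁ c)) → d ∣ iota (end (proj₁ c)) →
                     + index (Γ.end c) ≡ + index (Γ.beg c) + zeta (proj₁ c) [mod d ]
  end-≡[mod]-beg+ζ (x , i) d∣ιbeg d∣ιend = ≡[mod]-trans (end-≡[mod] x i d∣ιend)
    (+-congʳ-≡[mod] (zeta x) (≡[mod]-sym (beg-≡[mod] x i d∣ιbeg)))

  walk-end-≡[mod] : ∀ {d} c cs → IsWalk Cov (c ∷ cs) →
    All (λ x → d ∣ iota (beg x)) (πW (c ∷ cs)) → d ∣ iota (end (proj₁ (lastD Cov c cs))) →
    + index (Γ.end (lastD Cov c cs)) ≡ + index (Γ.beg c) + Σζ (πW (c ∷ cs)) [mod d ]
  walk-end-≡[mod] {d} c [] _ (d∣ι ∷ []) d∣ιend = begin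
    + index (Γ.end c)                           ≈⟨ end-≡[mod]-beg+ζ c d∣ι d∣ιend ⟩
    + index (Γ.beg c) + zeta (proj₁ c)          ≡⟨ cong (λ s → + index (Γ.beg c) + s) (ℤ.+-identityʳ (zeta (proj₁ c))) ⟨
    + index (Γ.beg c) + (zeta (proj₁ c) + + 0)  ∎
    where open ≈-Reasoning (≡[mod]-setoid d)
  walk-end-≡[mod] {d} c (e ∷ es) (beg-e≡end-c , walk) (d∣ι ∷ d∣ιs@(d∣ιe ∷ _)) d∣ιend = begin
    + index (Γ.end (lastD Cov e es))                ≈⟨ walk-end-≡[mod] e es walk d∣ιs d∣ιend ⟩
    + index (Γ.beg e) + Σζ (πW (e ∷ es))            ≡⟨ cong (λ v → + index v + Σζ (πW (e ∷ es))) beg-e≡end-c ⟩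
    + index (Γ.end c) + Σζ (πW (e ∷ es))            ≈⟨ +-congʳ-≡[mod] (Σζ (πW (e ∷ es)))
                                                         (end-≡[mod]-beg+ζ c d∣ι d∣ιendc) ⟩
    + index (Γ.beg c) + zeta x + Σζ (πW (e ∷ es))   ≡⟨ ℤ.+-assoc (+ index (Γ.beg c)) (zeta x) (Σζ (πW (e ∷ es))) ⟩
    + index (Γ.beg c) + Σζ (πW (c ∷ e ∷ es))        ∎
    where
    open ≈-Reasoning (≡[mod]-setoid d)
    x = proj₁ c
    d∣ιendc : d ∣ iota (end x)
    d∣ιendc = subst (λ v → d ∣ iota v) (cong proj₁ beg-e≡end-c) d∣ιe

  closed-walk-∣Σζ : ∀ {d} c cs → IsWalk Cov (c ∷ cs) → IsClosed Cov (c ∷ cs) →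
    All (λ x → d ∣ iota (beg x)) (πW (c ∷ cs)) → + d ∣ℤ Σζ (πW (c ∷ cs))
  closed-walk-∣Σζ {d} c cs walk closed d∣ιs@(d∣ι ∷ _) =
    Equivalence.to (+≡[mod]⇔∣ (+ index (Γ.beg c)) (Σζ (πW (c ∷ cs)))) (begin
      + index (Γ.beg c) + Σζ (πW (c ∷ cs))   ≈⟨ walk-end-≡[mod] c cs walk d∣ιs d∣ιend ⟨
      + index (Γ.end (lastD Cov c cs))       ≡⟨ cong (+_ ∘ index) closed ⟩
      + index (Γ.beg c)                      ∎)
    where
    open ≈-Reasoning (≡[mod]-setoid d)
    d∣ιend : d ∣ iota (end (proj₁ (lastD Cov c cs)))
    d∣ιend = subst (λ v → d ∣ iota v) (sym (cong proj₁ closed)) d∣ι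

  closed-walk-0∈endset : ∀ c cs → IsWalk Cov (c ∷ cs) → IsClosed Cov (c ∷ cs) →
                         InEndset (πW (c ∷ cs)) 0
  closed-walk-0∈endset c cs walk closed = ∣⇒∃[j][s+j*d]%ℕn≡0 _ _
    (closed-walk-∣Σζ c cs walk closed (map⁻ (foldr-gcd-∣ (map (iota ∘ beg) (πW (c ∷ cs))))))

  lam≡1⇒beg-injective : ∀ {c e : Γ.D} → proj₁ c ≡ proj₁ e → lam (proj₁ c) ≡ 1 →
                        Γ.beg c ≡ Γ.beg e → c ≡ e
  lam≡1⇒beg-injective {x , i} {.x , j} refl λx≡1 beg≡ = cong (x ,_) (toℕ-injective (begin
    toℕ i                     ≡⟨ below-ι i ⟨
    toℕ i % iota (beg x)      ≡⟨ index-beg x i ⟨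
    index (Γ.beg (x , i))     ≡⟨ cong index beg≡ ⟩
    index (Γ.beg (x , j))     ≡⟨ index-beg x j ⟩
    toℕ j % iota (beg x)      ≡⟨ below-ι j ⟩
    toℕ j                     ∎))
    where
    open ≡-Reasoning
    below-ι : (k : Fin (m x)) → toℕ k % iota (beg x) ≡ toℕ k
    below-ι k = m<n⇒m%n≡m (subst (toℕ k ℕ.<_)
      (trans (cong (ℕ._* iota (beg x)) λx≡1) (ℕ.*-identityˡ _)) (toℕ<n k))

  inv-index+ζ⁻¹-≡[mod] : ∀ x (i : Fin (m x)) →
    + toℕ (proj₂ (Γ.inv (x , i))) + zeta (inv x) ≡ + toℕ i [mod m x ]
  inv-index+ζ⁻¹-≡[mod] x i = begin
    + toℕ j + zeta (inv x)                              ≡⟨ cong (λ k → + k + zeta (inv x)) (index-inv x i) ⟩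
    + ((+ toℕ i + zeta x) %ℕ m (inv x)) + zeta (inv x)  ≈⟨ +-congʳ-≡[mod] (zeta (inv x))
                                                            (≡[mod]-∣ mx∣mx⁻¹ (%ℕ-≡[mod] (+ toℕ i + zeta x) (m (inv x)))) ⟩
    + toℕ i + zeta x + zeta (inv x)                     ≡⟨ ℤ.+-assoc (+ toℕ i) (zeta x) (zeta (inv x)) ⟩
    + toℕ i + (zeta x + zeta (inv x))                   ≈⟨ Equivalence.from (+≡[mod]⇔∣ (+ toℕ i) (zeta x + zeta (inv x)))
                                                            (ℤ∣.∣ᵤ⇒∣ mx∣ζx+ζx⁻¹) ⟩
    + toℕ i                                             ∎
    where
    open ≈-Reasoning (≡[mod]-setoid (m x))
    j = proj₂ (Γ.inv (x , i))
    mx∣mx⁻¹ : m x ∣ m (inv x)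
    mx∣mx⁻¹ = ℕ.∣-reflexive (lam-iota x)
    mx∣ζx+ζx⁻¹ : m x ∣ ℤ.∣ zeta x + zeta (inv x) ∣
    mx∣ζx+ζx⁻¹ = subst (λ z → m x ∣ ℤ.∣ z ∣) (ℤ.+-comm (zeta (inv x)) (zeta x)) (zeta-inv x)

  inv-involutive : (∀ x → inv (inv x) ≡ x) → ∀ c → Γ.inv (Γ.inv c) ≡ c
  inv-involutive inv-inv (x , i) = dart-≡ (inv-inv x) (begin
    toℕ (proj₂ (Γ.inv (inv x , j)))              ≡⟨ index-inv (inv x) j ⟩
    (+ toℕ j + zeta (inv x)) %ℕ m (inv (inv x))  ≡⟨ %ℕ-congʳ (+ toℕ j + zeta (inv x)) (cong m (inv-inv x)) ⟩
    (+ toℕ j + zeta (inv x)) %ℕ m x              ≡⟨ ≡[mod]⇒%ℕ≡ (m x) (inv-index+ζ⁻¹-≡[mod] x i) ⟩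
    toℕ i % m x                                  ≡⟨ m<n⇒m%n≡m (toℕ<n i) ⟩
    toℕ i                                        ∎)
    where
    open ≡-Reasoning
    j = proj₂ (Γ.inv (x , i))
    dart-≡ : ∀ {y} {k : Fin (m y)} → y ≡ x → toℕ k ≡ toℕ i → (y , k) ≡ (x , i)
    dart-≡ refl k≡i = cong (x ,_) (toℕ-injective k≡i)

  reduced-walk⇒lamReducedSteps : ∀ c cs → IsWalk Cov (c ∷ cs) → IsReduced Cov (c ∷ cs) →
                                 LamReducedSteps (proj₁ c) (map proj₁ cs)
  reduced-walk⇒lamReducedSteps c []       _                     _                 = tt
  reduced-walk⇒lamReducedSteps c (e ∷ es) (beg-e≡end-c , walk) (e≢c⁻¹ , reduced) =
    (λ λx⁻¹≡1 π-e≡x⁻¹ → e≢c⁻¹ (sym (lam≡1⇒beg-injective (sym π-e≡x⁻¹) λx⁻¹≡1 (sym beg-e≡end-c)))) ,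
    reduced-walk⇒lamReducedSteps e es walk reduced

  module _ (inv-inv : ∀ x → inv (inv x) ≡ x) where

    closed-walk-returning⇒last≡inv : ∀ c cs → IsClosed Cov (c ∷ cs) → lam (proj₁ c) ≡ 1 →
      proj₁ (lastD Cov c cs) ≡ inv (proj₁ c) → lastD Cov c cs ≡ Γ.inv c
    closed-walk-returning⇒last≡inv c cs closed λx≡1 πℓ≡x⁻¹ = begin
      ℓ                   ≡⟨ inv-involutive inv-inv ℓ ⟨
      Γ.inv (Γ.inv ℓ)     ≡⟨ cong Γ.inv ℓ⁻¹≡c ⟨
      Γ.inv c             ∎
      where
      open ≡-Reasoning
      ℓ = lastD Cov c cs
      ℓ⁻¹≡c : c ≡ Γ.inv ℓ
      ℓ⁻¹≡c = lam≡1⇒beg-injective (sym (trans (cong inv πℓ≡x⁻¹) (inv-inv (proj₁ c)))) λx≡1 (sym closed)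

    cycle⇒lamReducedClosing : (∀ c → Γ.beg c ≢ Γ.end c) → ∀ c cs → IsCycle Cov (c ∷ cs) →
      lam (proj₁ c) ≡ 1 → lastD Δ (proj₁ c) (map proj₁ cs) ≢ inv (proj₁ c)
    cycle⇒lamReducedClosing loopless c [] (_ , closed , _) _ _ = loopless c (sym closed)
    cycle⇒lamReducedClosing loopless c (e ∷ []) (_ , closed , (e≢c⁻¹ , _) , _) λx≡1 πe≡x⁻¹ =
      e≢c⁻¹ (closed-walk-returning⇒last≡inv c (e ∷ []) closed λx≡1 πe≡x⁻¹)
    cycle⇒lamReducedClosing loopless c (e ∷ g ∷ rs) ((beg-e≡end-c , _) , closed , _ , _ ∷ (beg-e∉ ∷ _))
                            λx≡1 πℓ≡x⁻¹ =
      All.lookup beg-e∉ (∈-map⁺ Γ.beg (lastD-∈ Cov g rs)) (trans beg-e≡end-c (sym (cong Γ.beg ℓ≡c⁻¹)))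
      where
      ℓ≡c⁻¹ : lastD Cov g rs ≡ Γ.inv c
      ℓ≡c⁻¹ = closed-walk-returning⇒last≡inv c (e ∷ g ∷ rs) closed λx≡1
        (trans (sym (lastD-map Cov Δ proj₁ g rs)) πℓ≡x⁻¹)

lemma6p2 : (Δ : PreGraph) (G : CGVGraph Δ) → IsCCV Δ G →
    (C : List (PreGraph.D (CGVGraph.Cov G))) → IsCycle (CGVGraph.Cov G) C →
    IsWalk Δ (CGVGraph.πW G C) × IsClosed Δ (CGVGraph.πW G C)
      × CGVGraph.LamReduced G (CGVGraph.πW G C)
      × CGVGraph.InEndset G (CGVGraph.πW G C) 0
lemma6p2 Δ G _ [] (_ , () , _)
lemma6p2 Δ G ((_ , _ , _ , inv-inv) , _ , _ , _ , _ , (loopless , _) , _) C@(c ∷ cs)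
         cycle@(walk , closed , reduced , _) =
  πW-walk C walk ,
  πW-closed C closed ,
  (reduced-walk⇒lamReducedSteps c cs walk reduced ,
   cycle⇒lamReducedClosing inv-inv loopless c cs cycle) ,
  closed-walk-0∈endset c cs walk closed
  where open CoverProjection Δ G
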